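{- Let $G$ and $H$ be graphs each containing a pair of disjoint forts. Then $G\,\Box\,H$ admits a barbell partition.
   Context: All graphs are finite and simple. A fort of a graph $G$ is a nonempty set $F\subseteq V(G)$ such that no vertex of $V(G)\setminus F$ is adjacent to exactly one vertex of $F$. $G\,\Box\,H$ has vertex set $V(G)\times V(H)$, with $(g_1,h_1)(g_2,h_2)$ an edge iff either $g_1=g_2$ and $h_1h_2\in E(H)$, or $h_1=h_2$ and $g_1g_2\in E(G)$. A barbell partition of a graph $K$ is a partition of $V(K)$ into three disjoint sets $\{R,W_1,W_2\}$ with $W_1,W_2\neq\emptyset$ ($R$ may be empty), no edges between $W_1$ and $W_2$, and $|N_K(r)\cap W_i|\neq 1$ for all $r\in R$, $i\in\{1,2\}$. -}

module Defs where

open import Data.Nat using (ℕ; _*_)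
open import Data.Bool using (Bool; true; false; _∧_; _∨_)
open import Data.Fin using (Fin; combine; remQuot)
open import Data.Fin.Properties using (_≟_)
open import Data.Fin.Subset using (Subset; _∈_; _∉_; _∩_; ∣_∣; Nonempty)
open import Data.Product using (_×_; _,_; Σ)
open import Data.Sum using (_⊎_)
open import Data.Vec using (tabulate)
open import Relation.Nullary using (¬_)
open import Relation.Nullary.Decidable using (⌊_⌋)
open import Relation.Binary.PropositionalEquality using (_≡_; _≢_; refl; cong₂)
import Relation.Binary.PropositionalEquality as ≡
open import Relation.Nullary using (yes; no)
open import Data.Empty using (⊥-elim)
open import Data.Bool.Properties using (∧-zeroʳ)

record Graph : Set where
  field
    n      : ℕ
    adj    : Fin n → Fin n → Bool
    adj-sym    : ∀ u v → adj u v ≡ adj v u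
    adj-irrefl : ∀ v → adj v v ≡ false

open Graph public

VSet : Graph → Set
VSet G = Subset (n G)

N : (G : Graph) → Fin (n G) → VSet G
N G v = tabulate (adj G v)

IsFort : (G : Graph) → VSet G → Set
IsFort G F = Nonempty F × (∀ v → v ∉ F → ∣ N G v ∩ F ∣ ≢ 1)

Disjoint : ∀ {k} → Subset k → Subset k → Set
Disjoint A B = ∀ x → x ∈ A → x ∉ B

HasDisjointForts : Graph → Set
HasDisjointForts G =
  Σ (VSet G) λ F₁ → Σ (VSet G) λ F₂ → IsFort G F₁ × IsFort G F₂ × Disjoint F₁ F₂

_==_ : ∀ {k} → Fin k → Fin k → Bool
x == y = ⌊ x ≟ y ⌋

==-sym : ∀ {k} (x y : Fin k) → (x == y) ≡ (y == x)
==-sym x y with x ≟ y | y ≟ x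
... | yes _ | yes _ = refl
... | no _  | no _  = refl
... | yes p | no q  = ⊥-elim (q (≡.sym p))
... | no q  | yes p = ⊥-elim (q (≡.sym p))

□-adj : (G H : Graph) → Fin (n G) × Fin (n H) → Fin (n G) × Fin (n H) → Bool
□-adj G H (g₁ , h₁) (g₂ , h₂) = ((g₁ == g₂) ∧ adj H h₁ h₂) ∨ ((h₁ == h₂) ∧ adj G g₁ g₂)

□-adj-sym : ∀ G H p q → □-adj G H p q ≡ □-adj G H q p
□-adj-sym G H (g₁ , h₁) (g₂ , h₂) =
  cong₂ _∨_ (cong₂ _∧_ (==-sym g₁ g₂) (adj-sym H h₁ h₂))
            (cong₂ _∧_ (==-sym h₁ h₂) (adj-sym G g₁ g₂))

□-adj-irrefl : ∀ G H p → □-adj G H p p ≡ false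
□-adj-irrefl G H (g , h) rewrite adj-irrefl H h | adj-irrefl G g | ∧-zeroʳ (g == g) | ∧-zeroʳ (h == h) = refl

-- Cartesian product G □ H. Its vertex set V(G) × V(H) is encoded as
-- Fin (n G * n H) via the stdlib bijection combine / remQuot
-- (vertex (g , h) is  combine g h).
_□_ : Graph → Graph → Graph
G □ H = record
  { n          = n G * n H
  ; adj        = λ x y → □-adj G H (remQuot (n H) x) (remQuot (n H) y)
  ; adj-sym    = λ x y → □-adj-sym G H (remQuot (n H) x) (remQuot (n H) y)
  ; adj-irrefl = λ x → □-adj-irrefl G H (remQuot (n H) x)
  }

record BarbellPartition (K : Graph) : Set where
  field
    R W₁ W₂   : VSet K
    cover     : ∀ v → v ∈ R ⊎ v ∈ W₁ ⊎ v ∈ W₂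
    disjRW₁   : Disjoint R W₁
    disjRW₂   : Disjoint R W₂
    disjW₁W₂  : Disjoint W₁ W₂
    W₁-ne     : Nonempty W₁
    W₂-ne     : Nonempty W₂
    noEdge    : ∀ x y → x ∈ W₁ → y ∈ W₂ → adj K x y ≡ false
    R-cond₁   : ∀ r → r ∈ R → ∣ N K r ∩ W₁ ∣ ≢ 1
    R-cond₂   : ∀ r → r ∈ R → ∣ N K r ∩ W₂ ∣ ≢ 1

{-# OPTIONS --safe #-}
-- If A and B are forts of G and H, then A × B is a fort of G □ H. A vertex (g , h) outside
-- A × B whose only neighbour there is (g , h') has g ∈ A, hence h ∉ B, and every neighbour
-- y ∈ B of h yields the neighbour (g , y) ∈ A × B; so h' is the only neighbour of h in B,
-- contradicting that B is a fort (neighbours (g' , h) are handled symmetrically).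
-- Disjoint forts A₁, A₂ of G and B₁, B₂ of H thus give forts A₁ × B₁ and A₂ × B₂ whose
-- vertices differ in both coordinates, so they are disjoint and non-adjacent, and with
-- R the remaining vertices they form a barbell partition.
module Submission where

open import Defs
open import Data.Nat using (ℕ; _*_)
open import Data.Nat.Properties using (suc-injective)
open import Data.Bool using (Bool; true; false; _∧_)
open import Data.Bool.Properties using (∨-zeroʳ)
open import Data.Fin using (Fin; zero; suc; combine; remQuot)
open import Data.Fin.Properties using (_≟_; remQuot-combine; combine-remQuot; combine-injectiveʳ; combine-injectiveˡ)
open import Data.Fin.Subset using (Subset; _∈_; _∉_; _∩_; _∪_; ∁; ∣_∣; Nonempty; ⁅_⁆; ⊥; inside; outside)
open import Data.Fin.Subset.Properties using (_∈?_; x∈p∩q⁺; x∈p∩q⁻; x∈p∪q⁺; x∈p∪q⁻; x∈∁p⇒x∉p; x∉p⇒x∈∁p; ⊆-antisym; x∈⁅x⁆; x∈⁅y⁆⇒x≡y; ∣⁅x⁆∣≡1)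
open import Data.Vec using ([]; _∷_; tabulate; lookup)
open import Data.Vec.Properties using (lookup∘tabulate; []=⇒lookup; lookup⇒[]=)
open import Data.Product using (_×_; _,_; ∃; proj₁; proj₂; uncurry)
open import Data.Sum using (_⊎_; inj₁; inj₂; [_,_])
open import Function using (_∘_)
open import Function.Definitions using (Injective)
open import Relation.Nullary using (yes; no)
open import Relation.Nullary.Decidable using (isYes≗does; dec-true; dec-false)
open import Relation.Binary.PropositionalEquality using (_≡_; _≢_; refl; sym; trans; cong; cong₂; subst; module ≡-Reasoning)

private
  variable
    a b : ℕ

∣p∣≡0⇒p≡⊥ : (p : Subset a) → ∣ p ∣ ≡ 0 → p ≡ ⊥
∣p∣≡0⇒p≡⊥ []            _ = refl
∣p∣≡0⇒p≡⊥ (outside ∷ p) e = cong (outside ∷_) (∣p∣≡0⇒p≡⊥ p e)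

∣p∣≡1⇒p≡⁅x⁆ : (p : Subset a) → ∣ p ∣ ≡ 1 → ∃ λ x → p ≡ ⁅ x ⁆
∣p∣≡1⇒p≡⁅x⁆ (inside  ∷ p) e = zero , cong (inside ∷_) (∣p∣≡0⇒p≡⊥ p (suc-injective e))
∣p∣≡1⇒p≡⁅x⁆ (outside ∷ p) e with ∣p∣≡1⇒p≡⁅x⁆ p e
... | x , refl = suc x , refl

p≡⁅x⁆⇒∣p∣≡1 : {p : Subset a} {x : Fin a} → p ≡ ⁅ x ⁆ → ∣ p ∣ ≡ 1
p≡⁅x⁆⇒∣p∣≡1 {x = x} refl = ∣⁅x⁆∣≡1 x

p≡⁅x⁆⇒x∈p : {p : Subset a} {x : Fin a} → p ≡ ⁅ x ⁆ → x ∈ p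
p≡⁅x⁆⇒x∈p {x = x} refl = x∈⁅x⁆ x

p≡⁅x⁆⇒y∈p⇒y≡x : {p : Subset a} {x y : Fin a} → p ≡ ⁅ x ⁆ → y ∈ p → y ≡ x
p≡⁅x⁆⇒y∈p⇒y≡x {x = x} refl = x∈⁅y⁆⇒x≡y x

⁅⁆-pullback : {φ : Fin a → Fin b} → Injective _≡_ _≡_ φ →
              {p : Subset a} {q : Subset b} {x : Fin a} →
              (∀ {y} → y ∈ p → φ y ∈ q) → x ∈ p → q ≡ ⁅ φ x ⁆ → p ≡ ⁅ x ⁆
⁅⁆-pullback φ-inj {p} {x = x} φ[p]⊆q x∈p q≡⁅φx⁆ = ⊆-antisym p⊆⁅x⁆ ⁅x⁆⊆p
  where
  p⊆⁅x⁆ : ∀ {y} → y ∈ p → y ∈ ⁅ x ⁆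
  p⊆⁅x⁆ y∈p with refl ← φ-inj (p≡⁅x⁆⇒y∈p⇒y≡x q≡⁅φx⁆ (φ[p]⊆q y∈p)) = x∈⁅x⁆ x
  ⁅x⁆⊆p : ∀ {y} → y ∈ ⁅ x ⁆ → y ∈ p
  ⁅x⁆⊆p y∈⁅x⁆ with refl ← x∈⁅y⁆⇒x≡y x y∈⁅x⁆ = x∈p

∈-tabulate⁺ : {f : Fin a → Bool} {x : Fin a} → f x ≡ true → x ∈ tabulate f
∈-tabulate⁺ {f = f} {x} fx≡true = lookup⇒[]= x (tabulate f) (trans (lookup∘tabulate f x) fx≡true)

∈-tabulate⁻ : {f : Fin a → Bool} {x : Fin a} → x ∈ tabulate f → f x ≡ true
∈-tabulate⁻ {f = f} {x} x∈ = trans (sym (lookup∘tabulate f x)) ([]=⇒lookup x∈)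

∈-N⁺ : (G : Graph) {u v : Fin (n G)} → adj G u v ≡ true → v ∈ N G u
∈-N⁺ G = ∈-tabulate⁺

∈-N⁻ : (G : Graph) {u v : Fin (n G)} → v ∈ N G u → adj G u v ≡ true
∈-N⁻ G = ∈-tabulate⁻

IsFort⇒N∩F≢⁅u⁆ : (G : Graph) {F : VSet G} → IsFort G F →
                 ∀ {v u} → v ∉ F → N G v ∩ F ≢ ⁅ u ⁆
IsFort⇒N∩F≢⁅u⁆ G (_ , outside-F) v∉F = outside-F _ v∉F ∘ p≡⁅x⁆⇒∣p∣≡1

separatedForts⇒BarbellPartition :
  (K : Graph) {F₁ F₂ : VSet K} → IsFort K F₁ → IsFort K F₂ → Disjoint F₁ F₂ →
  (∀ x y → x ∈ F₁ → y ∈ F₂ → adj K x y ≡ false) → BarbellPartition K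
separatedForts⇒BarbellPartition K {F₁} {F₂} (F₁-ne , outside-F₁) (F₂-ne , outside-F₂) F₁∩F₂=∅ noEdge = record
  { R        = R
  ; W₁       = F₁
  ; W₂       = F₂
  ; cover    = cover
  ; disjRW₁  = λ _ → R⇒∉F₁
  ; disjRW₂  = λ _ → R⇒∉F₂
  ; disjW₁W₂ = F₁∩F₂=∅
  ; W₁-ne    = F₁-ne
  ; W₂-ne    = F₂-ne
  ; noEdge   = noEdge
  ; R-cond₁  = λ r r∈R → outside-F₁ r (R⇒∉F₁ r∈R)
  ; R-cond₂  = λ r r∈R → outside-F₂ r (R⇒∉F₂ r∈R)
  }
  where
  R : VSet K
  R = ∁ (F₁ ∪ F₂)
  R⇒∉F₁ : ∀ {x} → x ∈ R → x ∉ F₁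
  R⇒∉F₁ x∈R x∈F₁ = x∈∁p⇒x∉p x∈R (x∈p∪q⁺ (inj₁ x∈F₁))
  R⇒∉F₂ : ∀ {x} → x ∈ R → x ∉ F₂
  R⇒∉F₂ x∈R x∈F₂ = x∈∁p⇒x∉p x∈R (x∈p∪q⁺ (inj₂ x∈F₂))
  cover : ∀ v → v ∈ R ⊎ v ∈ F₁ ⊎ v ∈ F₂
  cover v with v ∈? F₁ | v ∈? F₂
  ... | yes v∈F₁ | _        = inj₂ (inj₁ v∈F₁)
  ... | no  _    | yes v∈F₂ = inj₂ (inj₂ v∈F₂)
  ... | no  v∉F₁ | no  v∉F₂ = inj₁ (x∉p⇒x∈∁p λ v∈F₁∪F₂ → [ v∉F₁ , v∉F₂ ] (x∈p∪q⁻ F₁ F₂ v∈F₁∪F₂))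

==-refl : (x : Fin a) → (x == x) ≡ true
==-refl x = trans (isYes≗does (x ≟ x)) (dec-true (x ≟ x) refl)

≢⇒==-false : {x y : Fin a} → x ≢ y → (x == y) ≡ false
≢⇒==-false {x = x} {y} x≢y = trans (isYes≗does (x ≟ y)) (dec-false (x ≟ y) x≢y)

bothIn : Subset a → Subset b → Fin a × Fin b → Bool
bothIn A B (g , h) = lookup A g ∧ lookup B h

_⊠_ : Subset a → Subset b → Subset (a * b)
_⊠_ {b = b} A B = tabulate (bothIn A B ∘ remQuot b)

module _ {A : Subset a} {B : Subset b} {g : Fin a} {h : Fin b} where

  ⊠⁺ : g ∈ A → h ∈ B → combine g h ∈ A ⊠ B
  ⊠⁺ g∈A h∈B = ∈-tabulate⁺ (begin
    bothIn A B (remQuot b (combine g h)) ≡⟨ cong (bothIn A B) (remQuot-combine g h) ⟩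
    lookup A g ∧ lookup B h              ≡⟨ cong₂ _∧_ ([]=⇒lookup g∈A) ([]=⇒lookup h∈B) ⟩
    true                                 ∎)
    where open ≡-Reasoning

  ⊠⁻ : combine g h ∈ A ⊠ B → g ∈ A × h ∈ B
  ⊠⁻ gh∈A⊠B = split (trans (sym (cong (bothIn A B) (remQuot-combine g h))) (∈-tabulate⁻ gh∈A⊠B))
    where
    split : lookup A g ∧ lookup B h ≡ true → g ∈ A × h ∈ B
    split e with lookup A g in Ag | lookup B h in Bh
    split refl | true | true = lookup⇒[]= g A Ag , lookup⇒[]= h B Bh

module CartesianProduct (G H : Graph) where

  data Pair : Fin (n G * n H) → Set where
    ⟨_,_⟩ : (g : Fin (n G)) (h : Fin (n H)) → Pair (combine g h)

  pair : (x : Fin (n G * n H)) → Pair x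
  pair x = subst Pair (combine-remQuot {n G} (n H) x) ⟨ proj₁ gh , proj₂ gh ⟩
    where
    gh : Fin (n G) × Fin (n H)
    gh = remQuot {n G} (n H) x

  adj-□-combine : (g g' : Fin (n G)) (h h' : Fin (n H)) →
                  adj (G □ H) (combine g h) (combine g' h') ≡ □-adj G H (g , h) (g' , h')
  adj-□-combine g g' h h' = cong₂ (□-adj G H) (remQuot-combine g h) (remQuot-combine g' h')

  ∈-N-□-horizontal : (g : Fin (n G)) {h h' : Fin (n H)} →
                     h' ∈ N H h → combine g h' ∈ N (G □ H) (combine g h)
  ∈-N-□-horizontal g {h} {h'} h'∈N = ∈-N⁺ (G □ H) (trans (adj-□-combine g g h h') edge)
    where
    edge : □-adj G H (g , h) (g , h') ≡ true
    edge rewrite ==-refl g | ∈-N⁻ H h'∈N = refl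

  ∈-N-□-vertical : {g g' : Fin (n G)} (h : Fin (n H)) →
                   g' ∈ N G g → combine g' h ∈ N (G □ H) (combine g h)
  ∈-N-□-vertical {g} {g'} h g'∈N = ∈-N⁺ (G □ H) (trans (adj-□-combine g g' h h) edge)
    where
    edge : □-adj G H (g , h) (g' , h) ≡ true
    edge rewrite ==-refl h | ∈-N⁻ G g'∈N = ∨-zeroʳ _

  ∈-N-□⁻ : {g g' : Fin (n G)} {h h' : Fin (n H)} → combine g' h' ∈ N (G □ H) (combine g h) →
           (g ≡ g' × h' ∈ N H h) ⊎ (h ≡ h' × g' ∈ N G g)
  ∈-N-□⁻ {g} {g'} {h} {h'} g'h'∈N = cases (trans (sym (adj-□-combine g g' h h')) (∈-N⁻ (G □ H) g'h'∈N))
    where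
    cases : □-adj G H (g , h) (g' , h') ≡ true → (g ≡ g' × h' ∈ N H h) ⊎ (h ≡ h' × g' ∈ N G g)
    cases e with g ≟ g' | h ≟ h' | adj H h h' in hh' | adj G g g' in gg'
    ... | yes g≡g' | _        | true  | _     = inj₁ (g≡g' , ∈-N⁺ H hh')
    ... | _        | yes h≡h' | _     | true  = inj₂ (h≡h' , ∈-N⁺ G gg')
    ... | no  _    | no  _    | _     | _     with () ← e
    ... | yes _    | yes _    | false | false with () ← e
    ... | yes _    | no  _    | false | _     with () ← e
    ... | no  _    | yes _    | _     | false with () ← e

  adj-□-combine-false : {g g' : Fin (n G)} {h h' : Fin (n H)} → g ≢ g' → h ≢ h' →
                        adj (G □ H) (combine g h) (combine g' h') ≡ false
  adj-□-combine-false {g} {g'} {h} {h'} g≢g' h≢h'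
    rewrite adj-□-combine g g' h h' | ≢⇒==-false g≢g' | ≢⇒==-false h≢h' = refl

  ⊠-nonempty : {A : Subset (n G)} {B : Subset (n H)} → Nonempty A → Nonempty B → Nonempty (A ⊠ B)
  ⊠-nonempty (g , g∈A) (h , h∈B) = combine g h , ⊠⁺ g∈A h∈B

  module _ {A : Subset (n G)} {B : Subset (n H)} where

    N∩⊠≡⁅⁆⇒N∩B≡⁅⁆ : {g : Fin (n G)} {h h' : Fin (n H)} → g ∈ A → h' ∈ N H h → h' ∈ B →
                    N (G □ H) (combine g h) ∩ A ⊠ B ≡ ⁅ combine g h' ⁆ → N H h ∩ B ≡ ⁅ h' ⁆
    N∩⊠≡⁅⁆⇒N∩B≡⁅⁆ {g} g∈A h'∈N h'∈B =
      ⁅⁆-pullback (combine-injectiveʳ g _ g _) slice (x∈p∩q⁺ (h'∈N , h'∈B))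
      where
      slice : ∀ {y} → y ∈ N H _ ∩ B → combine g y ∈ N (G □ H) _ ∩ A ⊠ B
      slice y∈N∩B = let (y∈N , y∈B) = x∈p∩q⁻ _ _ y∈N∩B in
                    x∈p∩q⁺ (∈-N-□-horizontal g y∈N , ⊠⁺ g∈A y∈B)

    N∩⊠≡⁅⁆⇒N∩A≡⁅⁆ : {g g' : Fin (n G)} {h : Fin (n H)} → h ∈ B → g' ∈ N G g → g' ∈ A →
                    N (G □ H) (combine g h) ∩ A ⊠ B ≡ ⁅ combine g' h ⁆ → N G g ∩ A ≡ ⁅ g' ⁆
    N∩⊠≡⁅⁆⇒N∩A≡⁅⁆ {h = h} h∈B g'∈N g'∈A =
      ⁅⁆-pullback (combine-injectiveˡ _ h _ h) slice (x∈p∩q⁺ (g'∈N , g'∈A))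
      where
      slice : ∀ {y} → y ∈ N G _ ∩ A → combine y h ∈ N (G □ H) _ ∩ A ⊠ B
      slice y∈N∩A = let (y∈N , y∈A) = x∈p∩q⁻ _ _ y∈N∩A in
                    x∈p∩q⁺ (∈-N-□-vertical h y∈N , ⊠⁺ y∈A h∈B)

    ⊠-isFort : IsFort G A → IsFort H B → IsFort (G □ H) (A ⊠ B)
    ⊠-isFort fortA fortB = ⊠-nonempty (proj₁ fortA) (proj₁ fortB) , outside-A⊠B
      where
      outside-A⊠B : ∀ r → r ∉ A ⊠ B → ∣ N (G □ H) r ∩ A ⊠ B ∣ ≢ 1
      outside-A⊠B r r∉A⊠B ∣N∩A⊠B∣≡1 with pair r | ∣p∣≡1⇒p≡⁅x⁆ (N (G □ H) r ∩ A ⊠ B) ∣N∩A⊠B∣≡1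
      ... | ⟨ g , h ⟩ | w , N∩A⊠B≡⁅w⁆ with pair w | x∈p∩q⁻ _ _ (p≡⁅x⁆⇒x∈p N∩A⊠B≡⁅w⁆)
      ... | ⟨ g' , h' ⟩ | w∈N , w∈A⊠B with ⊠⁻ w∈A⊠B | ∈-N-□⁻ w∈N
      ... | g'∈A , h'∈B | inj₁ (refl , h'∈N) =
        IsFort⇒N∩F≢⁅u⁆ H fortB (λ h∈B → r∉A⊠B (⊠⁺ g'∈A h∈B)) (N∩⊠≡⁅⁆⇒N∩B≡⁅⁆ g'∈A h'∈N h'∈B N∩A⊠B≡⁅w⁆)
      ... | g'∈A , h'∈B | inj₂ (refl , g'∈N) =
        IsFort⇒N∩F≢⁅u⁆ G fortA (λ g∈A → r∉A⊠B (⊠⁺ g∈A h'∈B)) (N∩⊠≡⁅⁆⇒N∩A≡⁅⁆ h'∈B g'∈N g'∈A N∩A⊠B≡⁅w⁆)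

  ⊠-disjoint : {A₁ A₂ : Subset (n G)} (B₁ B₂ : Subset (n H)) → Disjoint A₁ A₂ → Disjoint (A₁ ⊠ B₁) (A₂ ⊠ B₂)
  ⊠-disjoint B₁ B₂ A₁∩A₂=∅ x x∈₁ x∈₂ with pair x
  ... | ⟨ g , h ⟩ = A₁∩A₂=∅ g (proj₁ (⊠⁻ {B = B₁} x∈₁)) (proj₁ (⊠⁻ {B = B₂} x∈₂))

  ⊠-nonadjacent : {A₁ A₂ : Subset (n G)} {B₁ B₂ : Subset (n H)} → Disjoint A₁ A₂ → Disjoint B₁ B₂ →
                  ∀ x y → x ∈ A₁ ⊠ B₁ → y ∈ A₂ ⊠ B₂ → adj (G □ H) x y ≡ false
  ⊠-nonadjacent {A₁} {A₂} {B₁} {B₂} A₁∩A₂=∅ B₁∩B₂=∅ x y x∈₁ y∈₂ with pair x | pair y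
  ... | ⟨ g , h ⟩ | ⟨ g' , h' ⟩ with ⊠⁻ {A = A₁} {B₁} x∈₁ | ⊠⁻ {A = A₂} {B₂} y∈₂
  ... | g∈A₁ , h∈B₁ | g'∈A₂ , h'∈B₂ =
    adj-□-combine-false (λ { refl → A₁∩A₂=∅ g g∈A₁ g'∈A₂ }) (λ { refl → B₁∩B₂=∅ h h∈B₁ h'∈B₂ })

mainTheorem16 : (G H : Graph) → HasDisjointForts G → HasDisjointForts H → BarbellPartition (G □ H)
mainTheorem16 G H (A₁ , A₂ , fortA₁ , fortA₂ , A₁∩A₂=∅) (B₁ , B₂ , fortB₁ , fortB₂ , B₁∩B₂=∅) =
  separatedForts⇒BarbellPartition (G □ H) (⊠-isFort fortA₁ fortB₁) (⊠-isFort fortA₂ fortB₂)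
    (⊠-disjoint B₁ B₂ A₁∩A₂=∅) (⊠-nonadjacent A₁∩A₂=∅ B₁∩B₂=∅)
  where open CartesianProduct G H
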